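{- Let $\Sigma$ be a one-sorted signature and let $t\colon\underline{h}\to\underline{k}$ and $s\colon\underline{m}\to\underline{n}$ be arrows of $\mathbf{Th}[\Sigma]$. Then the cells $\langle t\otimes s,\ \gamma_{\underline{n},\underline{k}},\ \gamma_{\underline{m},\underline{h}},\ s\otimes t\rangle$ and $\langle\gamma_{\underline{n},\underline{k}},\ t\otimes s,\ s\otimes t,\ \gamma_{\underline{m},\underline{h}}\rangle$ are generated by the pullback basis $\mathcal{B}(\Sigma)$.
   Context: $\mathbf{Th}[\Sigma]$ is the free algebraic (Lawvere) theory of $\Sigma$: objects are natural numbers $\underline{n}$; an arrow $\underline{n}\to\underline{m}$ is an $m$-tuple of $\Sigma$-terms over $x_1,\dots,x_n$; composition $\alpha;\beta$ (diagrammatic, $\alpha$ first) is substitution; $\otimes$ is juxtaposition on disjoint variable blocks. An $n$-ary $f\in\Sigma$ is the arrow $f\colon\underline{n}\to\underline{1}$. Symmetry $\gamma_{\underline{n},\underline{m}}=\langle x_{n+1},\dots,x_{n+m},x_1,\dots,x_n\rangle\colon\underline{n+m}\to\underline{m+n}$; duplicator $\nabla_{\underline{n}}=\langle x_1,\dots,x_n,x_1,\dots,x_n\rangle\colon\underline{n}\to\underline{2n}$. A cell is a quadruple $\langle s,u,v,t\rangle$ of arrows with $s\colon o_1\to o_0$, $u\colon o_2\to o_0$, $v\colon o_3\to o_1$, $t\colon o_3\to o_2$ and $t;u=v;s$. Identity cells: $\langle h,id,id,h\rangle$ and $\langle id,v,v,id\rangle$. Horizontal composition of $A=\langle s_1,u_1,v_1,t_1\rangle$,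 $B=\langle s_2,u_2,v_2,t_2\rangle$ with $v_1=u_2$: $A*B=\langle s_2;s_1,u_1,v_2,t_2;t_1\rangle$; vertical composition when $t_1=s_2$: $A\cdot B=\langle s_1,u_2;u_1,v_2;v_1,t_2\rangle$; parallel composition $\otimes$ componentwise. The pullback basis $\mathcal{B}(\Sigma)$ consists of, for each $n$-ary $f\in\Sigma$: $R_f=\langle f,f,id_{\underline{n}},id_{\underline{n}}\rangle$, $D_f=\langle f\otimes id_{\underline{1}},\nabla_{\underline{1}},\nabla_{\underline{n}};(id_{\underline{n}}\otimes f),f\rangle$, $\hat D_f=\langle\nabla_{\underline{1}},f\otimes id_{\underline{1}},f,\nabla_{\underline{n}};(id_{\underline{n}}\otimes f)\rangle$; and $R_\nabla=\langle\nabla_{\underline{1}},\nabla_{\underline{1}},id_{\underline{1}},id_{\underline{1}}\rangle$, $R_\gamma=\langle\gamma_{\underline{1},\underline{1}},\gamma_{\underline{1},\underline{1}},id_{\underline{2}},id_{\underline{2}}\rangle$, $D_\nabla=\langle\nabla_{\underline{1}}\otimes id_{\underline{1}},id_{\underline{1}}\otimes\nabla_{\underline{1}},\nabla_{\underline{1}},\nabla_{\underline{1}}\rangle$. A cell is generated by $\mathcal{B}(\Sigma)$ if obtained from cells of $\mathcal{B}(\Sigma)$ and identity cells by finitely many horizontal, vertical and parallel compositions. -}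

module Defs where

open import Data.Nat using (ℕ; _+_)
open import Data.Fin using (Fin; _↑ˡ_; _↑ʳ_)
open import Data.Vec using (Vec; []; _∷_; _++_; lookup; tabulate)
open import Relation.Binary.PropositionalEquality using (_≡_)

record Signature : Set₁ where
  field
    Op : Set
    ar : Op → ℕ

module FreeTheory (Σ : Signature) where
  open Signature Σ

  data Term (n : ℕ) : Set where
    var : Fin n → Term n
    op  : (f : Op) → Vec (Term n) (ar f) → Term n

  -- An arrow n → m of Th[Σ]: an m-tuple of terms over n variables.
  Arr : ℕ → ℕ → Set
  Arr n m = Vec (Term n) m

  mutual
    sub : ∀ {n m} → Arr n m → Term m → Term n
    sub α (var i)   = lookup α i
    sub α (op f ts) = op f (subs α ts)

    subs : ∀ {n m k} → Arr n m → Vec (Term m) k → Vec (Term n) k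
    subs α []       = []
    subs α (t ∷ ts) = sub α t ∷ subs α ts

  -- diagrammatic composition α ; β  (α first)
  infixl 5 _⨾_
  _⨾_ : ∀ {n m k} → Arr n m → Arr m k → Arr n k
  α ⨾ β = subs α β

  idA : ∀ n → Arr n n
  idA n = tabulate var

  inl : ∀ n n' → Arr (n + n') n
  inl n n' = tabulate (λ i → var (i ↑ˡ n'))

  inr : ∀ n n' → Arr (n + n') n'
  inr n n' = tabulate (λ i → var (n ↑ʳ i))

  infixr 6 _⊗_
  _⊗_ : ∀ {n m n' m'} → Arr n m → Arr n' m' → Arr (n + n') (m + m')
  _⊗_ {n} {m} {n'} {m'} α β = (inl n n' ⨾ α) ++ (inr n n' ⨾ β)

  opA : (f : Op) → Arr (ar f) 1
  opA f = op f (idA (ar f)) ∷ []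

  γ : ∀ n m → Arr (n + m) (m + n)
  γ n m = inr n m ++ inl n m

  ∇ : ∀ n → Arr n (n + n)
  ∇ n = idA n ++ idA n

  record Cell : Set where
    constructor ⟨_,_,_,_∣_⟩
    field
      {o₀ o₁ o₂ o₃} : ℕ
      s : Arr o₁ o₀
      u : Arr o₂ o₀
      v : Arr o₃ o₁
      t : Arr o₃ o₂
      comm : t ⨾ u ≡ v ⨾ s

  -- Cells generated by the pullback basis B(Σ): a predicate on quadruples
  -- ⟨s,u,v,t⟩ (the commutation condition is then automatic).
  data Gen : ∀ {o₀ o₁ o₂ o₃} → Arr o₁ o₀ → Arr o₂ o₀ → Arr o₃ o₁ → Arr o₃ o₂ → Set where
    R-op  : (f : Op) → Gen (opA f) (opA f) (idA (ar f)) (idA (ar f))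
    D-op  : (f : Op) → Gen (opA f ⊗ idA 1) (∇ 1) (∇ (ar f) ⨾ (idA (ar f) ⊗ opA f)) (opA f)
    D̂-op  : (f : Op) → Gen (∇ 1) (opA f ⊗ idA 1) (opA f) (∇ (ar f) ⨾ (idA (ar f) ⊗ opA f))
    R-∇   : Gen (∇ 1) (∇ 1) (idA 1) (idA 1)
    R-γ   : Gen (γ 1 1) (γ 1 1) (idA 2) (idA 2)
    D-∇   : Gen (∇ 1 ⊗ idA 1) (idA 1 ⊗ ∇ 1) (∇ 1) (∇ 1)
    id-h  : ∀ {o₀ o₁} (h : Arr o₁ o₀) → Gen h (idA o₀) (idA o₁) h
    id-v  : ∀ {o₀ o₃} (v : Arr o₃ o₀) → Gen (idA o₀) v v (idA o₃)
    hor   : ∀ {a₀ a₁ a₂ a₃ b₁ b₃}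
              {s₁ : Arr a₁ a₀} {u₁ : Arr a₂ a₀} {v₁ : Arr a₃ a₁} {t₁ : Arr a₃ a₂}
              {s₂ : Arr b₁ a₁} {v₂ : Arr b₃ b₁} {t₂ : Arr b₃ a₃} →
              Gen s₁ u₁ v₁ t₁ → Gen s₂ v₁ v₂ t₂ →
              Gen (s₂ ⨾ s₁) u₁ v₂ (t₂ ⨾ t₁)
    ver   : ∀ {a₀ a₁ a₂ a₃ b₂ b₃}
              {s₁ : Arr a₁ a₀} {u₁ : Arr a₂ a₀} {v₁ : Arr a₃ a₁} {t₁ : Arr a₃ a₂}
              {u₂ : Arr b₂ a₂} {v₂ : Arr b₃ a₃} {t₂ : Arr b₃ b₂} →
              Gen s₁ u₁ v₁ t₁ → Gen t₁ u₂ v₂ t₂ →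
              Gen s₁ (u₂ ⨾ u₁) (v₂ ⨾ v₁) t₂
    par   : ∀ {a₀ a₁ a₂ a₃ b₀ b₁ b₂ b₃}
              {s₁ : Arr a₁ a₀} {u₁ : Arr a₂ a₀} {v₁ : Arr a₃ a₁} {t₁ : Arr a₃ a₂}
              {s₂ : Arr b₁ b₀} {u₂ : Arr b₂ b₀} {v₂ : Arr b₃ b₁} {t₂ : Arr b₃ b₂} →
              Gen s₁ u₁ v₁ t₁ → Gen s₂ u₂ v₂ t₂ →
              Gen (s₁ ⊗ s₂) (u₁ ⊗ u₂) (v₁ ⊗ v₂) (t₁ ⊗ t₂)

{-# OPTIONS --safe #-}
module Submission where

-- Every cell ⟨π , π , id , id⟩ with π a renaming along a permutation is generated:
-- such cells contain R_γ, are closed under composition and ⊗, and every permutation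
-- is a product of transpositions of adjacent variables. The symmetry γ is such a
-- renaming, inverse to the opposite symmetry, and natural: γ_{h,m} ; (s ⊗ t) ; γ_{n,k} = t ⊗ s.
-- Pasting the cells of γ_{h,m} and γ_{n,k} with identity cells of s ⊗ t gives both cells.

open import Defs
open import Data.Nat using (zero; suc; _+_)
open import Data.Product using (_×_; _,_)
open import Data.Fin using (Fin; zero; suc; _↑ˡ_; _↑ʳ_; splitAt; join; punchIn; lift)
open import Data.Fin.Properties using (¬Fin0; join-splitAt; +↔⊎)
open import Data.Fin.Permutation using (Permutation; _⟨$⟩ʳ_; _⟨$⟩ˡ_; remove; punchIn-permute)
open import Data.Sum using (inj₁; inj₂; [_,_]′; swap)
open import Data.Sum.Properties using (swap-↔)
open import Data.Vec using (Vec; []; _∷_; _++_; lookup; tabulate)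
open import Data.Vec.Properties using (lookup-++ˡ; lookup-++ʳ; lookup-splitAt; lookup∘tabulate; tabulate∘lookup; tabulate-cong)
open import Data.Empty using (⊥-elim)
open import Function.Construct.Composition using (_↔-∘_)
open import Function.Construct.Symmetry using (↔-sym)
open import Relation.Binary.PropositionalEquality
  using (_≡_; refl; sym; trans; cong; cong₂; subst; module ≡-Reasoning)

module SymmetryCells (Σ : Signature) where
  open FreeTheory Σ
  open ≡-Reasoning

  lookup-subs : ∀ {n m k} (α : Arr n m) (ts : Vec (Term m) k) i →
                lookup (subs α ts) i ≡ sub α (lookup ts i)
  lookup-subs α (t ∷ ts) zero    = refl
  lookup-subs α (t ∷ ts) (suc i) = lookup-subs α ts i

  subs-tabulate : ∀ {n m k} (α : Arr n m) (f : Fin k → Term m) →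
                  subs α (tabulate f) ≡ tabulate (λ i → sub α (f i))
  subs-tabulate {k = zero}  α f = refl
  subs-tabulate {k = suc k} α f = cong (sub α (f zero) ∷_) (subs-tabulate α (λ i → f (suc i)))

  mutual
    sub-id : ∀ {n} (t : Term n) → sub (idA n) t ≡ t
    sub-id (var i)   = lookup∘tabulate var i
    sub-id (op f ts) = cong (op f) (subs-id ts)

    subs-id : ∀ {n k} (ts : Vec (Term n) k) → subs (idA n) ts ≡ ts
    subs-id []       = refl
    subs-id (t ∷ ts) = cong₂ _∷_ (sub-id t) (subs-id ts)

  mutual
    sub-⨾ : ∀ {n m k} (α : Arr n m) (β : Arr m k) (t : Term k) → sub (α ⨾ β) t ≡ sub α (sub β t)
    sub-⨾ α β (var i)   = lookup-subs α β i
    sub-⨾ α β (op f ts) = cong (op f) (subs-⨾ α β ts)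

    subs-⨾ : ∀ {n m k l} (α : Arr n m) (β : Arr m k) (ts : Vec (Term k) l) →
             subs (α ⨾ β) ts ≡ subs α (subs β ts)
    subs-⨾ α β []       = refl
    subs-⨾ α β (t ∷ ts) = cong₂ _∷_ (sub-⨾ α β t) (subs-⨾ α β ts)

  ⨾-identityˡ : ∀ {n m} (β : Arr n m) → idA n ⨾ β ≡ β
  ⨾-identityˡ = subs-id

  ⨾-identityʳ : ∀ {n m} (α : Arr n m) → α ⨾ idA m ≡ α
  ⨾-identityʳ α = trans (subs-tabulate α var) (tabulate∘lookup α)

  ⨾-assoc : ∀ {n m k l} (α : Arr n m) (β : Arr m k) (δ : Arr k l) → (α ⨾ β) ⨾ δ ≡ α ⨾ (β ⨾ δ)
  ⨾-assoc = subs-⨾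

  ⨾-++ : ∀ {n m a b} (α : Arr n m) (x : Arr m a) (y : Arr m b) → α ⨾ (x ++ y) ≡ (α ⨾ x) ++ (α ⨾ y)
  ⨾-++ α []      y = refl
  ⨾-++ α (t ∷ x) y = cong (sub α t ∷_) (⨾-++ α x y)

  ren : ∀ {n m} → (Fin m → Fin n) → Arr n m
  ren ρ = tabulate (λ i → var (ρ i))

  ren-cong : ∀ {n m} {ρ σ : Fin m → Fin n} → (∀ i → ρ i ≡ σ i) → ren ρ ≡ ren σ
  ren-cong ρ≗σ = tabulate-cong (λ i → cong var (ρ≗σ i))

  ren-⨾ : ∀ {n m k} (ρ : Fin m → Fin n) (σ : Fin k → Fin m) → ren ρ ⨾ ren σ ≡ ren (λ i → ρ (σ i))
  ren-⨾ ρ σ = trans (subs-tabulate (ren ρ) (λ i → var (σ i)))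
                    (tabulate-cong (λ i → lookup∘tabulate (λ j → var (ρ j)) (σ i)))

  ren-++ : ∀ {n a b} (ρ : Fin a → Fin n) (σ : Fin b → Fin n) →
           ren ρ ++ ren σ ≡ ren (λ i → [ ρ , σ ]′ (splitAt a i))
  ren-++ {a = a} ρ σ = trans (sym (tabulate∘lookup (ren ρ ++ ren σ)))
                             (tabulate-cong (λ i → trans (lookup-splitAt a (ren ρ) (ren σ) i)
                                                         (lookup-[,] (splitAt a i))))
    where
    lookup-[,] : ∀ x → [ lookup (ren ρ) , lookup (ren σ) ]′ x ≡ var ([ ρ , σ ]′ x)
    lookup-[,] (inj₁ i) = lookup∘tabulate _ i
    lookup-[,] (inj₂ i) = lookup∘tabulate _ i

  inl++inr : ∀ a b → inl a b ++ inr a b ≡ idA (a + b)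
  inl++inr a b = trans (ren-++ (_↑ˡ b) (a ↑ʳ_)) (ren-cong (join-splitAt a b))

  idA-⊗ : ∀ a b → idA a ⊗ idA b ≡ idA (a + b)
  idA-⊗ a b = trans (cong₂ _++_ (⨾-identityʳ (inl a b)) (⨾-identityʳ (inr a b))) (inl++inr a b)

  ++-⨾-inl : ∀ {o n k} (x : Arr o n) (y : Arr o k) → (x ++ y) ⨾ inl n k ≡ x
  ++-⨾-inl {k = k} x y =
    trans (subs-tabulate (x ++ y) (λ i → var (i ↑ˡ k)))
          (trans (tabulate-cong (lookup-++ˡ x y)) (tabulate∘lookup x))

  ++-⨾-inr : ∀ {o n k} (x : Arr o n) (y : Arr o k) → (x ++ y) ⨾ inr n k ≡ y
  ++-⨾-inr {n = n} x y =
    trans (subs-tabulate (x ++ y) (λ i → var (n ↑ʳ i)))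
          (trans (tabulate-cong (lookup-++ʳ x y)) (tabulate∘lookup y))

  ++-⨾-γ : ∀ {o n k} (x : Arr o n) (y : Arr o k) → (x ++ y) ⨾ γ n k ≡ y ++ x
  ++-⨾-γ {n = n} {k} x y = trans (⨾-++ (x ++ y) (inr n k) (inl n k))
                                 (cong₂ _++_ (++-⨾-inr x y) (++-⨾-inl x y))

  ++-⨾-⊗ : ∀ {o n m n' m'} (x : Arr o n) (y : Arr o n') (s : Arr n m) (t : Arr n' m') →
           (x ++ y) ⨾ (s ⊗ t) ≡ (x ⨾ s) ++ (y ⨾ t)
  ++-⨾-⊗ {n = n} {n' = n'} x y s t = begin
    (x ++ y) ⨾ ((inl n n' ⨾ s) ++ (inr n n' ⨾ t))
      ≡⟨ ⨾-++ (x ++ y) (inl n n' ⨾ s) (inr n n' ⨾ t) ⟩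
    ((x ++ y) ⨾ (inl n n' ⨾ s)) ++ ((x ++ y) ⨾ (inr n n' ⨾ t))
      ≡⟨ sym (cong₂ _++_ (⨾-assoc (x ++ y) (inl n n') s) (⨾-assoc (x ++ y) (inr n n') t)) ⟩
    ((x ++ y) ⨾ inl n n' ⨾ s) ++ ((x ++ y) ⨾ inr n n' ⨾ t)
      ≡⟨ cong₂ _++_ (cong (_⨾ s) (++-⨾-inl x y)) (cong (_⨾ t) (++-⨾-inr x y)) ⟩
    (x ⨾ s) ++ (y ⨾ t) ∎

  γ-involutive : ∀ m h → γ m h ⨾ γ h m ≡ idA (m + h)
  γ-involutive m h = trans (++-⨾-γ (inr m h) (inl m h)) (inl++inr m h)

  γ-natural : ∀ {h k m n} (t : Arr h k) (s : Arr m n) → γ h m ⨾ (s ⊗ t) ⨾ γ n k ≡ t ⊗ s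
  γ-natural {h} {k} {m} {n} t s = begin
    γ h m ⨾ (s ⊗ t) ⨾ γ n k                      ≡⟨ cong (_⨾ γ n k) (++-⨾-⊗ (inr h m) (inl h m) s t) ⟩
    ((inr h m ⨾ s) ++ (inl h m ⨾ t)) ⨾ γ n k     ≡⟨ ++-⨾-γ (inr h m ⨾ s) (inl h m ⨾ t) ⟩
    (inl h m ⨾ t) ++ (inr h m ⨾ s)               ∎

  γ-perm : ∀ p q → Permutation (q + p) (p + q)
  γ-perm p q = ↔-sym (+↔⊎ {p} {q}) ↔-∘ (swap-↔ ↔-∘ +↔⊎ {q} {p})

  γ-ren : ∀ p q → γ p q ≡ ren (γ-perm p q ⟨$⟩ʳ_)
  γ-ren p q = trans (ren-++ (p ↑ʳ_) (_↑ˡ q)) (ren-cong (λ i → join-swap (splitAt q i)))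
    where
    join-swap : ∀ x → [ p ↑ʳ_ , _↑ˡ q ]′ x ≡ join p q (swap x)
    join-swap (inj₁ _) = refl
    join-swap (inj₂ _) = refl

  castGen : ∀ {o₀ o₁ o₂ o₃} {s s' : Arr o₁ o₀} {u u' : Arr o₂ o₀} {v v' : Arr o₃ o₁} {t t' : Arr o₃ o₂} →
            s ≡ s' → u ≡ u' → v ≡ v' → t ≡ t' → Gen s u v t → Gen s' u' v' t'
  castGen refl refl refl refl g = g

  RCell : ∀ {n m} → Arr n m → Set
  RCell {n} a = Gen a a (idA n) (idA n)

  RCell-id : ∀ n → RCell (idA n)
  RCell-id n = id-h (idA n)

  RCell-⨾ : ∀ {n m k} {a : Arr n m} {b : Arr m k} → RCell a → RCell b → RCell (a ⨾ b)
  RCell-⨾ {n} {a = a} ra rb =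
    castGen refl refl refl (⨾-identityʳ (idA n))
      (hor (castGen refl refl (⨾-identityʳ a) refl (ver rb (id-v a))) ra)

  RCell-⊗ : ∀ {n m n' m'} {a : Arr n m} {b : Arr n' m'} → RCell a → RCell b → RCell (a ⊗ b)
  RCell-⊗ {n} {n' = n'} ra rb = castGen refl refl (idA-⊗ n n') (idA-⊗ n n') (par ra rb)

  idA-1⊗ren : ∀ {n m} (ρ : Fin m → Fin n) → idA 1 ⊗ ren ρ ≡ ren (lift 1 ρ)
  idA-1⊗ren ρ = cong (var zero ∷_) (ren-⨾ (1 ↑ʳ_) ρ)

  RCell-lift : ∀ {n m} {ρ : Fin m → Fin n} → RCell (ren ρ) → RCell (ren (lift 1 ρ))
  RCell-lift {ρ = ρ} r = subst RCell (idA-1⊗ren ρ) (RCell-⊗ (RCell-id 1) r)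

  swap₀₁ : ∀ {n} → Fin (2 + n) → Fin (2 + n)
  swap₀₁ zero          = suc zero
  swap₀₁ (suc zero)    = zero
  swap₀₁ (suc (suc i)) = suc (suc i)

  RCell-swap₀₁ : ∀ n → RCell (ren (swap₀₁ {n}))
  RCell-swap₀₁ n = subst RCell γ⊗id (RCell-⊗ R-γ (RCell-id n))
    where
    γ⊗id : γ 1 1 ⊗ idA n ≡ ren swap₀₁
    γ⊗id = cong (λ z → var (suc zero) ∷ var zero ∷ z) (⨾-identityʳ (inr 2 n))

  cycleTo : ∀ {n} → Fin (suc n) → Fin (suc n) → Fin (suc n)
  cycleTo j zero    = j
  cycleTo j (suc i) = punchIn j i

  RCell-cycleTo : ∀ {n} (j : Fin (suc n)) → RCell (ren (cycleTo j))
  RCell-cycleTo zero    = RCell-id _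
  RCell-cycleTo {suc n} (suc j) =
    subst RCell (trans (ren-⨾ (lift 1 (cycleTo j)) swap₀₁) (ren-cong lift∘swap))
      (RCell-⨾ (RCell-lift {ρ = cycleTo j} (RCell-cycleTo j)) (RCell-swap₀₁ n))
    where
    lift∘swap : ∀ i → lift 1 (cycleTo j) (swap₀₁ i) ≡ cycleTo (suc j) i
    lift∘swap zero          = refl
    lift∘swap (suc zero)    = refl
    lift∘swap (suc (suc i)) = refl

  RCell-perm : ∀ {m n} (π : Permutation m n) → RCell (ren (π ⟨$⟩ʳ_))
  RCell-perm {zero}  {zero}  π = id-h []
  RCell-perm {zero}  {suc n} π = ⊥-elim (¬Fin0 (π ⟨$⟩ˡ zero))
  RCell-perm {suc m} {zero}  π = ⊥-elim (¬Fin0 (π ⟨$⟩ʳ zero))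
  RCell-perm {suc m} {suc n} π =
    subst RCell (trans (ren-⨾ (cycleTo j) (lift 1 (remove zero π ⟨$⟩ʳ_))) (ren-cong split))
      (RCell-⨾ (RCell-cycleTo j) (RCell-lift (RCell-perm (remove zero π))))
    where
    j : Fin (suc n)
    j = π ⟨$⟩ʳ zero

    split : ∀ i → cycleTo j (lift 1 (remove zero π ⟨$⟩ʳ_) i) ≡ π ⟨$⟩ʳ i
    split zero    = refl
    split (suc i) = sym (punchIn-permute π zero i)

  RCell-γ : ∀ p q → RCell (γ p q)
  RCell-γ p q = subst RCell (sym (γ-ren p q)) (RCell-perm (γ-perm p q))

  module _ {a b c d} {σ : Arr a b} {σ⁻¹ : Arr b a} {τ : Arr c d}
           (rσ : RCell σ) (rτ : RCell τ) (σ⁻¹⨾σ : σ⁻¹ ⨾ σ ≡ idA b) (x : Arr b c) where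

    Gen-conjugate : Gen (σ ⨾ x ⨾ τ) τ σ⁻¹ x
    Gen-conjugate = castGen refl refl refl (⨾-identityʳ x) (hor rτ σ⨾x-cell)
      where
      σ-cell : Gen σ (idA b) σ⁻¹ (idA b)
      σ-cell = castGen refl σ⁻¹⨾σ (⨾-identityʳ σ⁻¹) refl (ver rσ (id-v σ⁻¹))

      σ⨾x-cell : Gen (σ ⨾ x) (idA c) σ⁻¹ x
      σ⨾x-cell = castGen refl refl refl (⨾-identityˡ x) (hor (id-h x) σ-cell)

    Gen-conjugateᵀ : Gen τ (σ ⨾ x ⨾ τ) x σ⁻¹
    Gen-conjugateᵀ = castGen refl refl (⨾-identityʳ x) refl (ver rτ σ⨾x-cell)
      where
      σ-cell : Gen (idA b) σ (idA b) σ⁻¹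
      σ-cell = castGen σ⁻¹⨾σ refl refl (⨾-identityʳ σ⁻¹) (hor rσ (id-h σ⁻¹))

      σ⨾x-cell : Gen (idA c) (σ ⨾ x) x σ⁻¹
      σ⨾x-cell = castGen refl refl (⨾-identityˡ x) refl (ver (id-v x) σ-cell)

lemma3p7 : (Σ : Signature) → let open FreeTheory Σ in
    ∀ {h k m n} (t : Arr h k) (s : Arr m n) →
      Gen (t ⊗ s) (γ n k) (γ m h) (s ⊗ t)
      × Gen (γ n k) (t ⊗ s) (s ⊗ t) (γ m h)
lemma3p7 Σ {h} {k} {m} {n} t s =
    castGen (γ-natural t s) refl refl refl
      (Gen-conjugate (RCell-γ h m) (RCell-γ n k) (γ-involutive m h) (s ⊗ t))
  , castGen refl (γ-natural t s) refl refl
      (Gen-conjugateᵀ (RCell-γ h m) (RCell-γ n k) (γ-involutive m h) (s ⊗ t))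
  where
  open FreeTheory Σ
  open SymmetryCells Σ
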